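{- Let $p\geq 2$ and let $T$ be a tree with $r_p(T)=p+1$. Let $D$ be a $\gamma_p(T)$-set. Then (i) $PN_p(x,D,T)\neq\emptyset$ for every $x\in D$; and (ii) $D$ is the unique $\gamma_p(T)$-set.
   Context: All graphs are finite, simple and undirected. For a graph $G=(V,E)$ and a positive integer $p$, a set $D\subseteq V$ is a $p$-dominating set if every vertex not in $D$ has at least $p$ neighbours in $D$; $\gamma_p(G)$ is the minimum cardinality of a $p$-dominating set, and a $p$-dominating set of this size is a $\gamma_p(G)$-set. The $p$-reinforcement number is $r_p(G)=\min\{|B| : B\subseteq E(G^c),\ \gamma_p(G+B)<\gamma_p(G)\}$, where $G^c$ is the complement and $G+B$ is $G$ with the edges of $B$ added; by convention $r_p(G)=0$ if $\gamma_p(G)\leq p$. For $x\in V$ and $X\subseteq V$, a vertex $y\in V\setminus X$ is a $p$-private neighbour of $x$ with respect to $X$ if $xy\in E$ and $|N_G(y)\cap X|=p$; $PN_p(x,X,G)$ denotes the set of such vertices. -}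

module Defs where

open import Data.Nat using (ℕ; zero; suc; _+_; _≤_; _<_)
open import Data.Bool using (Bool; true; false; _∨_; _∧_; if_then_else_)
open import Data.Fin using (Fin; zero; suc; inject₁; fromℕ; _<?_)
open import Data.Fin.Subset using (Subset; _∈_; _∉_; _∩_; ∣_∣)
open import Data.Vec using (tabulate)
open import Data.List using (List; map; allFin)
open import Data.Nat.ListAction using (sum)
open import Data.Empty using (⊥)
open import Data.Product using (Σ; ∃; _×_; ∃-syntax)
open import Data.Sum using (_⊎_)
open import Relation.Binary.PropositionalEquality using (_≡_)
open import Relation.Nullary.Decidable using (⌊_⌋)
open import Function.Definitions using (Injective)

Adj : ℕ → Set
Adj n = Fin n → Fin n → Bool

record IsSimple {n : ℕ} (G : Adj n) : Set where
  field
    sym     : ∀ i j → G i j ≡ G j i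
    irrefl  : ∀ i → G i i ≡ false

N : ∀ {n} → Adj n → Fin n → Subset n
N G v = tabulate (G v)

data Walk {n : ℕ} (G : Adj n) : Fin n → Fin n → Set where
  here : ∀ {u} → Walk G u u
  step : ∀ {u v w} → G u v ≡ true → Walk G v w → Walk G u w

Connected : ∀ {n} → Adj n → Set
Connected {n} G = ∀ (u v : Fin n) → Walk G u v

HasCycle : ∀ {n} → Adj n → Set
HasCycle {n} G =
  ∃[ k ] Σ (Fin (3 + k) → Fin n) λ c →
    Injective _≡_ _≡_ c
    × (∀ (i : Fin (2 + k)) → G (c (inject₁ i)) (c (suc i)) ≡ true)
    × G (c (fromℕ (2 + k))) (c zero) ≡ true

IsTree : ∀ {n} → Adj n → Set
IsTree G = IsSimple G × Connected G × (HasCycle G → ⊥)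

IsPDominating : ∀ {n} → Adj n → ℕ → Subset n → Set
IsPDominating G p D = ∀ v → v ∉ D → p ≤ ∣ N G v ∩ D ∣

IsGammaSet : ∀ {n} → Adj n → ℕ → Subset n → Set
IsGammaSet G p D = IsPDominating G p D × (∀ D′ → IsPDominating G p D′ → ∣ D ∣ ≤ ∣ D′ ∣)

IsGamma : ∀ {n} → Adj n → ℕ → ℕ → Set
IsGamma G p g = ∃[ D ] (IsGammaSet G p D × ∣ D ∣ ≡ g)

_⊕_ : ∀ {n} → Adj n → Adj n → Adj n
(G ⊕ B) i j = G i j ∨ B i j

edgeCount : ∀ {n} → Adj n → ℕ
edgeCount {n} B =
  sum (map (λ i → sum (map (λ j → if ⌊ i <? j ⌋ ∧ B i j then 1 else 0) (allFin n))) (allFin n))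

Reinforcing : ∀ {n} → Adj n → ℕ → Adj n → Set
Reinforcing G p B =
  IsSimple B × (∀ i j → B i j ≡ true → G i j ≡ false)
  × ∃[ g ] ∃[ g′ ] (IsGamma G p g × IsGamma (G ⊕ B) p g′ × g′ < g)

-- k = r_p(G)  (with the convention r_p(G) = 0 when γ_p(G) ≤ p)
IsReinforcementNumber : ∀ {n} → Adj n → ℕ → ℕ → Set
IsReinforcementNumber G p k =
  (∃[ g ] (IsGamma G p g × g ≤ p) × k ≡ 0)
  ⊎ ((∃[ g ] (IsGamma G p g × p < g))
     × (∃[ B ] (Reinforcing G p B × edgeCount B ≡ k))
     × (∀ B → Reinforcing G p B → k ≤ edgeCount B))

IsPrivateNbr : ∀ {n} → Adj n → ℕ → Fin n → Subset n → Fin n → Set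
IsPrivateNbr G p x X y = y ∉ X × G x y ≡ true × ∣ N G y ∩ X ∣ ≡ p

module Submission where

-- Part (i) rests on an explicit reinforcement, valid in every graph G.  If γ_p(G) = |D| > p,
-- x ∈ D has a neighbours in D, and every added edge set lowering γ_p has at least p + 1
-- edges, then: joining x to p ∸ a vertices of D − x and each p-private neighbour of x to a
-- vertex of D − x makes D − x p-dominating, so p + 1 ≤ (p ∸ a) + |PN_p(x, D)|.
--
-- Part (ii) compares D with a second γ_p-set D′ through X = D − D′, Y = D′ − D and the set Q
-- of vertices outside D ∪ D′ that are p-private neighbours of vertices of X.  The inequality of part (i) gives every
-- x ∈ X two neighbours in Y ∪ Q, and each q ∈ Q has a neighbour in Y.  Since a forest has
-- fewer edges than vertices inside any nonempty vertex set, |Y| > |X| unless X ∪ Y ∪ Q is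
-- empty, while |D′| ≤ |D| gives |Y| ≤ |X|; hence D′ = D.

open import Defs
open import Data.Nat using (ℕ; zero; suc; _+_; _*_; _∸_; _≤_; _<_; z≤n; s≤s; _≤?_; _<?_)
open import Data.Nat.Properties
open import Data.Nat.Induction using (<-rec)
open import Data.Nat.Tactic.RingSolver using (solve-∀)
open import Data.Bool using (Bool; true; false; _∧_; _∨_; not)
import Data.Bool as Bool
open import Data.Bool.Properties using (∨-comm; ∨-zeroʳ; ∨-identityʳ; ∧-comm; ∧-zeroʳ; ∧-identityʳ; ∧-assoc)
open import Data.Fin using (Fin; zero; suc; toℕ; inject₁; fromℕ)
import Data.Fin.Properties as Fin
open import Data.Fin.Subset using (Subset; _∈_; _∉_; _∩_; ∣_∣; ⁅_⁆)
open import Data.Fin.Subset.Properties using (anySubset?; _∈?_; x∈⁅x⁆; x∈⁅y⁆⇒x≡y; ∣⁅x⁆∣≡1)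
open import Data.Vec using ([]; _∷_; lookup; tabulate)
open import Data.Vec.Functional using () renaming (_∷_ to _◂_)
open import Data.Vec.Properties using ([]=⇒lookup; lookup⇒[]=; lookup∘tabulate; tabulate∘lookup; tabulate-cong; lookup-zipWith)
open import Data.List using (map; allFin)
import Data.List as List
open import Data.List.Properties using (map-tabulate)
open import Data.Nat.ListAction using () renaming (sum to listSum)
open import Data.Product using (_×_; _,_; proj₁; proj₂; ∃-syntax)
open import Data.Sum using (_⊎_; inj₁; inj₂)
open import Data.Empty using (⊥; ⊥-elim)
open import Function using (_∘_)
open import Function.Definitions using (Injective)
open import Relation.Binary.PropositionalEquality
open import Relation.Binary.Definitions using (tri<; tri≈; tri>)
open import Relation.Nullary using (¬_; Dec; yes; no)
open import Relation.Nullary.Decidable using (⌊_⌋; _×-dec_; _→-dec_; ¬?)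
open import Algebra.Properties.CommutativeMonoid.Sum +-0-commutativeMonoid
  using (sum; sum-syntax; sum-cong-≗; sum-replicate-zero; ∑-distrib-+; ∑-comm)

VSet : ℕ → Set
VSet n = Fin n → Bool

⟦_⟧ : Bool → ℕ
⟦ true ⟧  = 1
⟦ false ⟧ = 0

⟦⟧≤1 : ∀ b → ⟦ b ⟧ ≤ 1
⟦⟧≤1 true  = ≤-refl
⟦⟧≤1 false = z≤n

count : ∀ {n} → VSet n → ℕ
count {n} A = ∑[ i < n ] ⟦ A i ⟧

_⊆_ : ∀ {n} → VSet n → VSet n → Set
A ⊆ B = ∀ u → A u ≡ true → B u ≡ true

Disjoint : ∀ {n} → VSet n → VSet n → Set
Disjoint A B = ∀ u → A u ≡ true → B u ≡ false

_&_ _─_ _∪_ : ∀ {n} → VSet n → VSet n → VSet n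
(A & B) u = A u ∧ B u
(A ─ B) u = A u ∧ not (B u)
(A ∪ B) u = A u ∨ B u

∅ : ∀ {n} → VSet n
∅ _ = false

⟪_⟫ : ∀ {n} → Fin n → VSet n
⟪ c ⟫ = lookup ⁅ c ⁆

∧-true : ∀ {a b} → a ∧ b ≡ true → a ≡ true × b ≡ true
∧-true {true} {true} _ = refl , refl

not-true : ∀ {a} → not a ≡ true → a ≡ false
not-true {false} _ = refl

∨-true : ∀ {a b} → a ∨ b ≡ true → a ≡ true ⊎ b ≡ true
∨-true {true}  _ = inj₁ refl
∨-true {false} b = inj₂ b

false≢true : false ≢ true
false≢true ()

true-or-false : ∀ b → b ≡ true ⊎ b ≡ false
true-or-false true  = inj₁ refl
true-or-false false = inj₂ refl

∑-mono : ∀ {n} {f g : Fin n → ℕ} → (∀ i → f i ≤ g i) → sum f ≤ sum g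
∑-mono {zero}  _ = z≤n
∑-mono {suc n} f≤g = +-mono-≤ (f≤g zero) (∑-mono (f≤g ∘ suc))

∑-scale : ∀ {n} k (f : Fin n → ℕ) → ∑[ i < n ] (k * f i) ≡ k * sum f
∑-scale {zero}  k f = sym (*-zeroʳ k)
∑-scale {suc n} k f = trans (cong (k * f zero +_) (∑-scale k (f ∘ suc))) (sym (*-distribˡ-+ k (f zero) _))

count-cong : ∀ {n} {A B : VSet n} → (∀ u → A u ≡ B u) → count A ≡ count B
count-cong A≗B = sum-cong-≗ (cong ⟦_⟧ ∘ A≗B)

count-∅ : ∀ {n} → count (∅ {n}) ≡ 0
count-∅ {n} = sum-replicate-zero n

count-mono : ∀ {n} {A B : VSet n} → A ⊆ B → count A ≤ count B
count-mono {A = A} {B} A⊆B = ∑-mono pointwise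
  where
  pointwise : ∀ u → ⟦ A u ⟧ ≤ ⟦ B u ⟧
  pointwise u with A u in eq
  ... | false = z≤n
  ... | true rewrite A⊆B u eq = ≤-refl

count-disjoint : ∀ {n} {A B C : VSet n} → A ⊆ C → B ⊆ C → Disjoint A B → count A + count B ≤ count C
count-disjoint {A = A} {B} {C} A⊆C B⊆C A∩B=∅ =
  subst (_≤ count C) (∑-distrib-+ (⟦_⟧ ∘ A) (⟦_⟧ ∘ B)) (∑-mono pointwise)
  where
  pointwise : ∀ u → ⟦ A u ⟧ + ⟦ B u ⟧ ≤ ⟦ C u ⟧
  pointwise u with A u in eqA
  ... | true rewrite A∩B=∅ u eqA | A⊆C u eqA = ≤-refl
  ... | false with B u in eqB
  ...   | true rewrite B⊆C u eqB = ≤-refl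
  ...   | false = z≤n

count-split : ∀ {n} (A B : VSet n) → count A ≡ count (A & B) + count (A ─ B)
count-split A B = trans (sum-cong-≗ pointwise) (∑-distrib-+ (⟦_⟧ ∘ (A & B)) (⟦_⟧ ∘ (A ─ B)))
  where
  pointwise : ∀ u → ⟦ A u ⟧ ≡ ⟦ (A & B) u ⟧ + ⟦ (A ─ B) u ⟧
  pointwise u with A u | B u
  ... | true  | true  = refl
  ... | true  | false = refl
  ... | false | _     = refl

count-∪ : ∀ {n} {A B : VSet n} → Disjoint A B → count (A ∪ B) ≡ count A + count B
count-∪ {A = A} {B} A∩B=∅ = trans (sum-cong-≗ pointwise) (∑-distrib-+ (⟦_⟧ ∘ A) (⟦_⟧ ∘ B))
  where
  pointwise : ∀ u → ⟦ (A ∪ B) u ⟧ ≡ ⟦ A u ⟧ + ⟦ B u ⟧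
  pointwise u with A u in eqA
  ... | true  rewrite A∩B=∅ u eqA = refl
  ... | false = refl

count-witness : ∀ {n} (A : VSet n) → 0 < count A → ∃[ u ] A u ≡ true
count-witness {suc n} A pos with A zero in eq
... | true  = zero , eq
... | false = let u , Au = count-witness (A ∘ suc) pos in suc u , Au

∣∣≡count : ∀ {n} (S : Subset n) → ∣ S ∣ ≡ count (lookup S)
∣∣≡count []          = refl
∣∣≡count (true ∷ S)  = cong suc (∣∣≡count S)
∣∣≡count (false ∷ S) = ∣∣≡count S

⟪⟫-self : ∀ {n} (c : Fin n) → ⟪ c ⟫ c ≡ true
⟪⟫-self c = []=⇒lookup (x∈⁅x⁆ c)

⟪⟫-elim : ∀ {n} {c u : Fin n} → ⟪ c ⟫ u ≡ true → u ≡ c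
⟪⟫-elim {c = c} {u} eq = x∈⁅y⁆⇒x≡y c (lookup⇒[]= u ⁅ c ⁆ eq)

count-⟪⟫ : ∀ {n} (c : Fin n) → count ⟪ c ⟫ ≡ 1
count-⟪⟫ c = trans (sym (∣∣≡count ⁅ c ⁆)) (∣⁅x⁆∣≡1 c)

⟪⟫-other : ∀ {n} {c u : Fin n} → u ≢ c → ⟪ c ⟫ u ≡ false
⟪⟫-other {c = c} {u} u≢c with ⟪ c ⟫ u in eq
... | true  = ⊥-elim (u≢c (⟪⟫-elim eq))
... | false = refl

⟪⟫⊆ : ∀ {n} {A : VSet n} {c} → A c ≡ true → ⟪ c ⟫ ⊆ A
⟪⟫⊆ {A = A} Ac u eq = subst (λ v → A v ≡ true) (sym (⟪⟫-elim eq)) Ac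

count-∋ : ∀ {n} (A : VSet n) {c} → A c ≡ true → 1 ≤ count A
count-∋ {n} A {c} Ac = subst (_≤ count A) (count-⟪⟫ c) (count-mono {n} (⟪⟫⊆ Ac))

count-zero : ∀ {n} (A : VSet n) → count A ≡ 0 → ∀ u → A u ≡ false
count-zero A count≡0 u with A u in eq
... | false = refl
... | true  = ⊥-elim (1+n≰n (subst (1 ≤_) count≡0 (count-∋ A eq)))

count-guarded-⟪⟫ : ∀ {n} b (c : Fin n) → count (λ u → b ∧ ⟪ c ⟫ u) ≡ ⟦ b ⟧
count-guarded-⟪⟫ true  c = count-⟪⟫ c
count-guarded-⟪⟫ {n} false c = count-∅ {n}

count-point : ∀ {n} (A : VSet n) c → count (A & ⟪ c ⟫) ≡ ⟦ A c ⟧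
count-point {n} A c with A c in eq
... | true  = trans (count-cong pointwise) (count-⟪⟫ c)
  where
  pointwise : ∀ u → (A & ⟪ c ⟫) u ≡ ⟪ c ⟫ u
  pointwise u with ⟪ c ⟫ u in e
  ... | true  = trans (cong (λ v → A v ∧ true) (⟪⟫-elim e)) (cong (_∧ true) eq)
  ... | false = ∧-zeroʳ (A u)
... | false = trans (count-cong pointwise) (count-∅ {n})
  where
  pointwise : ∀ u → (A & ⟪ c ⟫) u ≡ false
  pointwise u with ⟪ c ⟫ u in e
  ... | true  = trans (cong (λ v → A v ∧ true) (⟪⟫-elim e)) (cong (_∧ true) eq)
  ... | false = ∧-zeroʳ (A u)

count-remove : ∀ {n} (A : VSet n) c → count A ≡ count (A ─ ⟪ c ⟫) + ⟦ A c ⟧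
count-remove A c = begin
  count A                                ≡⟨ count-split A ⟪ c ⟫ ⟩
  count (A & ⟪ c ⟫) + count (A ─ ⟪ c ⟫)  ≡⟨ +-comm (count (A & ⟪ c ⟫)) (count (A ─ ⟪ c ⟫)) ⟩
  count (A ─ ⟪ c ⟫) + count (A & ⟪ c ⟫)  ≡⟨ cong (count (A ─ ⟪ c ⟫) +_) (count-point A c) ⟩
  count (A ─ ⟪ c ⟫) + ⟦ A c ⟧            ∎
  where open ≡-Reasoning

count-∪-≤ : ∀ {n} (A B : VSet n) → count (A ∪ B) ≤ count A + count B
count-∪-≤ A B = subst (count (A ∪ B) ≤_) (∑-distrib-+ (⟦_⟧ ∘ A) (⟦_⟧ ∘ B)) (∑-mono pointwise)
  where
  pointwise : ∀ u → ⟦ A u ∨ B u ⟧ ≤ ⟦ A u ⟧ + ⟦ B u ⟧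
  pointwise u with A u
  ... | true  = s≤s z≤n
  ... | false = ≤-refl

◂-⊆ : ∀ {n b} {A : VSet (suc n)} {K : VSet n} → (b ≡ true → A zero ≡ true) → K ⊆ (A ∘ suc) → (b ◂ K) ⊆ A
◂-⊆ head _   zero    = head
◂-⊆ _    K⊆A (suc u) = K⊆A u

take : ∀ {n} k (A : VSet n) → k ≤ count A → ∃[ K ] (K ⊆ A × count K ≡ k)
take {zero}  zero    A _ = ∅ , (λ _ ()) , refl
take {suc n} zero    A _ = ∅ , (λ _ ()) , count-∅ {suc n}
take {suc n} (suc k) A k<∣A∣ with A zero in A₀
... | true  = let K , K⊆A , ∣K∣ = take k (A ∘ suc) (≤-pred k<∣A∣)
              in (true ◂ K) , ◂-⊆ (λ _ → A₀) K⊆A , cong suc ∣K∣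
... | false = let K , K⊆A , ∣K∣ = take (suc k) (A ∘ suc) k<∣A∣
              in (false ◂ K) , ◂-⊆ (λ ()) K⊆A , ∣K∣

choose : ∀ {n} → VSet n → Fin n → Fin n
choose A d with Fin.any? (λ u → A u Bool.≟ true)
... | yes (u , _) = u
... | no _        = d

choose-∈ : ∀ {n} (A : VSet n) d → 0 < count A → A (choose A d) ≡ true
choose-∈ A d nonempty with Fin.any? (λ u → A u Bool.≟ true)
... | yes (_ , Au) = Au
... | no  none     = ⊥-elim (none (count-witness A nonempty))

does-true : ∀ {a} {P : Set a} (d : Dec P) → ⌊ d ⌋ ≡ true → P
does-true (yes p) _ = p

does-false : ∀ {a} {P : Set a} (d : Dec P) → ⌊ d ⌋ ≡ false → ¬ P
does-false (no ¬p) _ = ¬p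

true-does : ∀ {a} {P : Set a} (d : Dec P) → P → ⌊ d ⌋ ≡ true
true-does (yes _) _ = refl
true-does (no ¬p) p = ⊥-elim (¬p p)

false-does : ∀ {a} {P : Set a} (d : Dec P) → ¬ P → ⌊ d ⌋ ≡ false
false-does (yes p) ¬p = ⊥-elim (¬p p)
false-does (no _)  _  = refl

nbrs : ∀ {n} → Adj n → VSet n → Fin n → VSet n
nbrs G A v u = G v u ∧ A u

deg : ∀ {n} → Adj n → VSet n → Fin n → ℕ
deg G A v = count (nbrs G A v)

∣N∩∣≡deg : ∀ {n} (G : Adj n) (S : Subset n) v → ∣ N G v ∩ S ∣ ≡ deg G (lookup S) v
∣N∩∣≡deg G S v = trans (∣∣≡count (N G v ∩ S)) (count-cong lookup-N∩)
  where
  lookup-N∩ : ∀ u → lookup (N G v ∩ S) u ≡ G v u ∧ lookup S u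
  lookup-N∩ u = trans (lookup-zipWith _∧_ u (tabulate (G v)) S) (cong (_∧ lookup S u) (lookup∘tabulate (G v) u))

deg≤count : ∀ {n} (G : Adj n) A v → deg G A v ≤ count A
deg≤count G A v = count-mono λ u e → proj₂ (∧-true {G v u} e)

deg-remove : ∀ {n} (G : Adj n) (A : VSet n) v c → deg G A v ≡ deg G (A ─ ⟪ c ⟫) v + ⟦ G v c ∧ A c ⟧
deg-remove G A v c =
  trans (count-remove (nbrs G A v) c) (cong (_+ ⟦ G v c ∧ A c ⟧) (count-cong λ u → ∧-assoc (G v u) (A u) _))

deg-split : ∀ {n} (G : Adj n) A B v → deg G A v ≡ deg G (A & B) v + deg G (A ─ B) v
deg-split G A B v = trans (count-split (nbrs G A v) B)
  (cong₂ _+_ (count-cong λ u → ∧-assoc (G v u) (A u) (B u)) (count-cong λ u → ∧-assoc (G v u) (A u) _))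

deg-mono : ∀ {n} (G : Adj n) {A B : VSet n} v → A ⊆ B → deg G A v ≤ deg G B v
deg-mono G v A⊆B = count-mono λ u e → let Gvu , Au = ∧-true {G v u} e in cong₂ _∧_ Gvu (A⊆B u Au)

nbrs-⊕ : ∀ {n} (G B : Adj n) A v → nbrs G A v ⊆ nbrs (G ⊕ B) A v
nbrs-⊕ G B A v u Guv∧Au = let Guv , Au = ∧-true {G v u} Guv∧Au in cong₂ _∧_ (cong (_∨ B v u) Guv) Au

new-nbr : ∀ {n} (G B : Adj n) {A v u} → B v u ≡ true → A u ≡ true → nbrs (G ⊕ B) A v u ≡ true
new-nbr G B {v = v} {u} Bvu Au = cong₂ _∧_ (trans (cong (G v u ∨_) Bvu) (∨-zeroʳ (G v u))) Au

∈⇒true : ∀ {n} {x : Fin n} {S : Subset n} → x ∈ S → lookup S x ≡ true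
∈⇒true = []=⇒lookup

true⇒∈ : ∀ {n} {x : Fin n} {S : Subset n} → lookup S x ≡ true → x ∈ S
true⇒∈ {x = x} {S} = lookup⇒[]= x S

∉⇒false : ∀ {n} {x : Fin n} {S : Subset n} → x ∉ S → lookup S x ≡ false
∉⇒false {x = x} {S} x∉S with lookup S x in eq
... | true  = ⊥-elim (x∉S (true⇒∈ eq))
... | false = refl

false⇒∉ : ∀ {n} {x : Fin n} {S : Subset n} → lookup S x ≡ false → x ∉ S
false⇒∉ eq x∈S with trans (sym (∈⇒true x∈S)) eq
... | ()

Dominating : ∀ {n} → Adj n → ℕ → VSet n → Set
Dominating G p A = ∀ v → A v ≡ false → p ≤ deg G A v

dominating⇒ : ∀ {n} {G : Adj n} {p} {S : Subset n} → IsPDominating G p S → Dominating G p (lookup S)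
dominating⇒ {G = G} {S = S} dom v v∉S = subst (_ ≤_) (∣N∩∣≡deg G S v) (dom v (false⇒∉ v∉S))

⇒dominating : ∀ {n} {G : Adj n} {p} {A : VSet n} → Dominating G p A → IsPDominating G p (tabulate A)
⇒dominating {G = G} {A = A} dom v v∉S =
  subst (_ ≤_) (sym (trans (∣N∩∣≡deg G (tabulate A) v) (count-cong λ u → cong (G v u ∧_) (lookup∘tabulate A u))))
        (dom v (trans (sym (lookup∘tabulate A v)) (∉⇒false v∉S)))

dominating? : ∀ {n} (G : Adj n) p (S : Subset n) → Dec (IsPDominating G p S)
dominating? G p S = Fin.all? (λ v → ¬? (v ∈? S) →-dec (p ≤? ∣ N G v ∩ S ∣))

γ-set-below : ∀ {n} (G : Adj n) p (S₀ : Subset n) → IsPDominating G p S₀ → ∃[ S ] (IsGammaSet G p S × ∣ S ∣ ≤ ∣ S₀ ∣)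
γ-set-below G p S₀ = search ∣ S₀ ∣ S₀ ≤-refl
  where
  search : ∀ k S₀ → ∣ S₀ ∣ ≤ k → IsPDominating G p S₀ → ∃[ S ] (IsGammaSet G p S × ∣ S ∣ ≤ ∣ S₀ ∣)
  search k S₀ ∣S₀∣≤k dom with anySubset? (λ S → dominating? G p S ×-dec (suc ∣ S ∣ ≤? ∣ S₀ ∣))
  ... | no none-smaller = S₀ , (dom , λ S dom′ → ≮⇒≥ (λ smaller → none-smaller (S , dom′ , smaller))) , ≤-refl
  search zero S₀ ∣S₀∣≤0 dom | yes (S₁ , _ , smaller) = ⊥-elim (≤⇒≯ ∣S₀∣≤0 (≤-trans (s≤s z≤n) smaller))
  search (suc k) S₀ ∣S₀∣≤k dom | yes (S₁ , dom₁ , smaller) =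
    let S , γ-set , ∣S∣≤∣S₁∣ = search k S₁ (≤-pred (≤-trans smaller ∣S₀∣≤k)) dom₁
    in S , γ-set , ≤-trans ∣S∣≤∣S₁∣ (<⇒≤ smaller)

-- Ordered pairs (v , u) with v ∈ A, u ∈ B and v adjacent to u; pairs G W W is twice the
-- number of edges inside W.
pairs : ∀ {n} → Adj n → VSet n → VSet n → ℕ
pairs {n} G A B = ∑[ v < n ] count (λ u → A v ∧ (G v u ∧ B u))

∑∑-distrib-+ : ∀ {n} (f g : Fin n → Fin n → ℕ) →
  ∑[ v < n ] ∑[ u < n ] (f v u + g v u) ≡ ∑[ v < n ] ∑[ u < n ] f v u + ∑[ v < n ] ∑[ u < n ] g v u
∑∑-distrib-+ {n} f g =
  trans (sum-cong-≗ (λ v → ∑-distrib-+ (f v) (g v))) (∑-distrib-+ (λ v → sum (f v)) (λ v → sum (g v)))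

∧-swap-outer : ∀ a t b → a ∧ (t ∧ b) ≡ b ∧ (t ∧ a)
∧-swap-outer true  t true  = refl
∧-swap-outer true  t false = ∧-zeroʳ t
∧-swap-outer false t true  = sym (∧-zeroʳ t)
∧-swap-outer false t false = refl

pairs-cong : ∀ {n} (G : Adj n) {A A′ B B′ : VSet n} → (∀ v → A v ≡ A′ v) → (∀ u → B u ≡ B′ u) →
  pairs G A B ≡ pairs G A′ B′
pairs-cong G A≗A′ B≗B′ = sum-cong-≗ λ v → count-cong λ u → cong₂ (λ a b → a ∧ (G v u ∧ b)) (A≗A′ v) (B≗B′ u)

pairs-sym : ∀ {n} {G : Adj n} → IsSimple G → ∀ A B → pairs G A B ≡ pairs G B A
pairs-sym {G = G} simple A B = trans (∑-comm (λ v u → ⟦ A v ∧ (G v u ∧ B u) ⟧))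
  (sum-cong-≗ λ u → count-cong λ v →
    trans (cong (λ t → A v ∧ (t ∧ B u)) (IsSimple.sym simple v u)) (∧-swap-outer (A v) (G u v) (B u)))

pairs-∪ˡ : ∀ {n} (G : Adj n) {A A′ : VSet n} B → Disjoint A A′ → pairs G (A ∪ A′) B ≡ pairs G A B + pairs G A′ B
pairs-∪ˡ G {A} {A′} B A∩A′=∅ =
  trans (sum-cong-≗ λ v → sum-cong-≗ λ u → pointwise v (G v u ∧ B u))
        (∑∑-distrib-+ (λ v u → ⟦ A v ∧ (G v u ∧ B u) ⟧) (λ v u → ⟦ A′ v ∧ (G v u ∧ B u) ⟧))
  where
  pointwise : ∀ v r → ⟦ (A v ∨ A′ v) ∧ r ⟧ ≡ ⟦ A v ∧ r ⟧ + ⟦ A′ v ∧ r ⟧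
  pointwise v r with A v in eq
  ... | true  rewrite A∩A′=∅ v eq = sym (+-identityʳ ⟦ r ⟧)
  ... | false = refl

pairs-∪ʳ : ∀ {n} {G : Adj n} → IsSimple G → ∀ A {B B′ : VSet n} → Disjoint B B′ →
  pairs G A (B ∪ B′) ≡ pairs G A B + pairs G A B′
pairs-∪ʳ {G = G} simple A {B} {B′} B∩B′=∅ = begin
  pairs G A (B ∪ B′)          ≡⟨ pairs-sym simple A (B ∪ B′) ⟩
  pairs G (B ∪ B′) A          ≡⟨ pairs-∪ˡ G A B∩B′=∅ ⟩
  pairs G B A + pairs G B′ A  ≡⟨ cong₂ _+_ (pairs-sym simple B A) (pairs-sym simple B′ A) ⟩
  pairs G A B + pairs G A B′  ∎
  where open ≡-Reasoning

pairs-monoʳ : ∀ {n} (G : Adj n) A {B B′ : VSet n} → B ⊆ B′ → pairs G A B ≤ pairs G A B′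
pairs-monoʳ G A B⊆B′ = ∑-mono λ v → count-mono λ u eq →
  let Av , GB = ∧-true {A v} eq ; Gvu , Bu = ∧-true {G v u} GB
  in cong₂ _∧_ Av (cong₂ _∧_ Gvu (B⊆B′ u Bu))

pairs-⟪⟫ʳ : ∀ {n} {G : Adj n} → IsSimple G → ∀ A ℓ → pairs G A ⟪ ℓ ⟫ ≡ deg G A ℓ
pairs-⟪⟫ʳ {G = G} simple A ℓ =
  trans (sum-cong-≗ λ v → trans (count-cong λ u → sym (∧-assoc (A v) (G v u) (⟪ ℓ ⟫ u)))
                                (count-point (λ u → A v ∧ G v u) ℓ))
        (count-cong λ v → trans (∧-comm (A v) (G v ℓ)) (cong (_∧ A v) (IsSimple.sym simple v ℓ)))

pairs-empty : ∀ {n} (G : Adj n) A B → count A ≡ 0 → pairs G A B ≡ 0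
pairs-empty {n} G A B ∣A∣≡0 = begin
  pairs G A B    ≡⟨ pairs-cong G (count-zero A ∣A∣≡0) (λ _ → refl) ⟩
  pairs G ∅ B    ≡⟨ sum-cong-≗ {n} {λ _ → count (∅ {n})} (λ _ → count-∅ {n}) ⟩
  ∑[ v < n ] 0   ≡⟨ count-∅ {n} ⟩
  0              ∎
  where open ≡-Reasoning

pairs-lower : ∀ {n} (G : Adj n) A B k → (∀ v → A v ≡ true → k ≤ deg G B v) → k * count A ≤ pairs G A B
pairs-lower G A B k many = subst (_≤ pairs G A B) (∑-scale k (⟦_⟧ ∘ A)) (∑-mono pointwise)
  where
  pointwise : ∀ v → k * ⟦ A v ⟧ ≤ count (λ u → A v ∧ (G v u ∧ B u))
  pointwise v with A v in eq
  ... | true  = subst (_≤ deg G B v) (sym (*-identityʳ k)) (many v eq)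
  ... | false = subst (_≤ count (λ u → false ∧ (G v u ∧ B u))) (sym (*-zeroʳ k)) z≤n

pairs-three : ∀ {n} {G : Adj n} → IsSimple G → ∀ {X Y Q : VSet n} → Disjoint X (Y ∪ Q) → Disjoint Y Q →
  2 * pairs G X (Y ∪ Q) + 2 * pairs G Q Y ≤ pairs G (X ∪ (Y ∪ Q)) (X ∪ (Y ∪ Q))
pairs-three {G = G} simple {X} {Y} {Q} X∩Z=∅ Y∩Q=∅ = begin
  2 * pairs G X Z + 2 * pairs G Q Y
    ≡⟨ arithmetic (pairs G X Z) (pairs G Q Y) ⟩
  pairs G X Z + (pairs G X Z + (pairs G Q Y + pairs G Q Y))
    ≤⟨ +-mono-≤ (m≤n+m _ (pairs G X X))
                (+-mono-≤ (≤-reflexive (pairs-sym simple X Z))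
                          (+-mono-≤ (≤-trans (≤-reflexive (pairs-sym simple Q Y)) (pairs-monoʳ G Y Q⊆Z))
                                    (pairs-monoʳ G Q Y⊆Z))) ⟩
  (pairs G X X + pairs G X Z) + (pairs G Z X + (pairs G Y Z + pairs G Q Z))
    ≡⟨ cong₂ _+_ (pairs-∪ʳ simple X X∩Z=∅) (cong (pairs G Z X +_) (pairs-∪ˡ G Z Y∩Q=∅)) ⟨
  pairs G X (X ∪ Z) + (pairs G Z X + pairs G Z Z)
    ≡⟨ cong (pairs G X (X ∪ Z) +_) (pairs-∪ʳ simple Z X∩Z=∅) ⟨
  pairs G X (X ∪ Z) + pairs G Z (X ∪ Z)
    ≡⟨ pairs-∪ˡ G (X ∪ Z) X∩Z=∅ ⟨
  pairs G (X ∪ Z) (X ∪ Z)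
    ∎
  where
  open ≤-Reasoning
  Z = Y ∪ Q
  Y⊆Z : Y ⊆ Z
  Y⊆Z u Yu = cong (_∨ Q u) Yu
  Q⊆Z : Q ⊆ Z
  Q⊆Z u Qu = trans (cong (Y u ∨_) Qu) (∨-zeroʳ (Y u))
  arithmetic : ∀ a b → 2 * a + 2 * b ≡ a + (a + (b + b))
  arithmetic = solve-∀

listSum≡∑ : ∀ {n} (f : Fin n → ℕ) → listSum (map f (allFin n)) ≡ sum f
listSum≡∑ {n} f = trans (cong listSum (map-tabulate (λ i → i) f)) (tabulated f)
  where
  tabulated : ∀ {m} (h : Fin m → ℕ) → listSum (List.tabulate h) ≡ sum h
  tabulated {zero}  h = refl
  tabulated {suc m} h = cong (h zero +_) (tabulated (h ∘ suc))

ite≡⟦⟧ : ∀ b → (Bool.if b then 1 else 0) ≡ ⟦ b ⟧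
ite≡⟦⟧ true  = refl
ite≡⟦⟧ false = refl

_<ᶠ_ : ∀ {n} → Fin n → Fin n → Bool
i <ᶠ j = ⌊ i Fin.<? j ⌋

<ᶠ-asym : ∀ {n} (i j : Fin n) → i <ᶠ j ≡ true → j <ᶠ i ≡ false
<ᶠ-asym i j i<j = false-does (j Fin.<? i) (Fin.<-asym (does-true (i Fin.<? j) i<j))

edgeCount≡∑ : ∀ {n} (B : Adj n) → edgeCount B ≡ ∑[ i < n ] ∑[ j < n ] ⟦ i <ᶠ j ∧ B i j ⟧
edgeCount≡∑ {n} B =
  trans (listSum≡∑ {n} (λ i → listSum (map (entry i) (allFin n))))
        (sum-cong-≗ λ i → trans (listSum≡∑ (entry i)) (sum-cong-≗ λ j → ite≡⟦⟧ (i <ᶠ j ∧ B i j)))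
  where
  entry : Fin n → Fin n → ℕ
  entry i j = Bool.if i <ᶠ j ∧ B i j then 1 else 0

symmetrise : ∀ {n} → Adj n → Adj n
symmetrise R i j = R i j ∨ R j i

-- The symmetric closure of R has at most as many edges as R has entries: each edge
-- {i , j} with i < j is paid for by R i j or by R j i.
edgeCount-symmetrise : ∀ {n} (R : Adj n) → edgeCount (symmetrise R) ≤ ∑[ i < n ] count (R i)
edgeCount-symmetrise {n} R = begin
  edgeCount (symmetrise R)
    ≡⟨ edgeCount≡∑ (symmetrise R) ⟩
  ∑[ i < n ] ∑[ j < n ] ⟦ i <ᶠ j ∧ (R i j ∨ R j i) ⟧
    ≤⟨ ∑-mono (λ i → ∑-mono λ j → split (i <ᶠ j) (R i j) (R j i)) ⟩
  ∑[ i < n ] ∑[ j < n ] (⟦ i <ᶠ j ∧ R i j ⟧ + ⟦ i <ᶠ j ∧ R j i ⟧)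
    ≡⟨ ∑∑-distrib-+ (λ i j → ⟦ i <ᶠ j ∧ R i j ⟧) (λ i j → ⟦ i <ᶠ j ∧ R j i ⟧) ⟩
  ∑[ i < n ] ∑[ j < n ] ⟦ i <ᶠ j ∧ R i j ⟧ + ∑[ i < n ] ∑[ j < n ] ⟦ i <ᶠ j ∧ R j i ⟧
    ≡⟨ cong (∑[ i < n ] ∑[ j < n ] ⟦ i <ᶠ j ∧ R i j ⟧ +_) (∑-comm (λ i j → ⟦ i <ᶠ j ∧ R j i ⟧)) ⟩
  ∑[ i < n ] ∑[ j < n ] ⟦ i <ᶠ j ∧ R i j ⟧ + ∑[ i < n ] ∑[ j < n ] ⟦ j <ᶠ i ∧ R i j ⟧
    ≡⟨ ∑∑-distrib-+ (λ i j → ⟦ i <ᶠ j ∧ R i j ⟧) (λ i j → ⟦ j <ᶠ i ∧ R i j ⟧) ⟨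
  ∑[ i < n ] ∑[ j < n ] (⟦ i <ᶠ j ∧ R i j ⟧ + ⟦ j <ᶠ i ∧ R i j ⟧)
    ≤⟨ ∑-mono (λ i → ∑-mono λ j → one-direction (i <ᶠ j) (j <ᶠ i) (R i j) (<ᶠ-asym i j)) ⟩
  ∑[ i < n ] count (R i)
    ∎
  where
  open ≤-Reasoning
  split : ∀ l r s → ⟦ l ∧ (r ∨ s) ⟧ ≤ ⟦ l ∧ r ⟧ + ⟦ l ∧ s ⟧
  split false _     _ = z≤n
  split true  true  _ = s≤s z≤n
  split true  false _ = ≤-refl
  one-direction : ∀ l l′ r → (l ≡ true → l′ ≡ false) → ⟦ l ∧ r ⟧ + ⟦ l′ ∧ r ⟧ ≤ ⟦ r ⟧
  one-direction true  _  r l⇒¬l′ rewrite l⇒¬l′ refl = ≤-reflexive (+-identityʳ ⟦ r ⟧)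
  one-direction false true  r _ = ≤-refl
  one-direction false false r _ = z≤n

privateNbr : ∀ {n} → Adj n → ℕ → VSet n → Fin n → VSet n
privateNbr G p A x v = not (A v) ∧ (G x v ∧ ⌊ deg G A v ≟ p ⌋)

privateNbr-spec : ∀ {n} {G : Adj n} {p A x v} → privateNbr G p A x v ≡ true →
  A v ≡ false × G x v ≡ true × deg G A v ≡ p
privateNbr-spec {G = G} {p} {A} {x} {v} eq =
  let ¬Av , rest = ∧-true {not (A v)} eq ; Gxv , deg≡p = ∧-true {G x v} rest
  in not-true ¬Av , Gxv , does-true (deg G A v ≟ p) deg≡p

-- Let D be a γ_p-set of a graph G with more than p vertices, x ∈ D, and a the number of
-- neighbours of x in D.  Join x to p ∸ a vertices of D − x that are not adjacent to it, and
-- every p-private neighbour v of x to some vertex of D − x not adjacent to v.  Then D − x is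
-- p-dominating, so γ_p drops, at the price of (p ∸ a) + |PN_p(x, D)| new edges.
module PrivateReinforcement {n} {G : Adj n} (simple : IsSimple G) {p} {D : Subset n}
  (γ-set : IsGammaSet G p D) (p<∣D∣ : p < ∣ D ∣) {x} (x∈D : lookup D x ≡ true) where

  Dᵇ S : VSet n
  Dᵇ = lookup D
  S  = Dᵇ ─ ⟪ x ⟫

  a : ℕ
  a = deg G Dᵇ x

  PN : VSet n
  PN = privateNbr G p Dᵇ x

  PN-spec : ∀ {v} → PN v ≡ true → Dᵇ v ≡ false × G x v ≡ true × deg G Dᵇ v ≡ p
  PN-spec = privateNbr-spec {G = G} {p} {Dᵇ} {x}

  far : Fin n → VSet n
  far v = S ─ G v

  ∣D∣≡∣S∣+1 : ∣ D ∣ ≡ count S + 1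
  ∣D∣≡∣S∣+1 = trans (∣∣≡count D) (trans (count-remove Dᵇ x) (cong (λ b → count S + ⟦ b ⟧) x∈D))

  p≤∣S∣ : p ≤ count S
  p≤∣S∣ = ≤-pred (subst (suc p ≤_) (trans ∣D∣≡∣S∣+1 (+-comm (count S) 1)) p<∣D∣)

  deg-D : ∀ v → deg G Dᵇ v ≡ deg G S v + ⟦ G v x ⟧
  deg-D v = begin
    deg G Dᵇ v                  ≡⟨ deg-remove G Dᵇ v x ⟩
    deg G S v + ⟦ G v x ∧ Dᵇ x ⟧ ≡⟨ cong (λ b → deg G S v + ⟦ G v x ∧ b ⟧) x∈D ⟩
    deg G S v + ⟦ G v x ∧ true ⟧ ≡⟨ cong (λ b → deg G S v + ⟦ b ⟧) (∧-identityʳ (G v x)) ⟩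
    deg G S v + ⟦ G v x ⟧        ∎
    where open ≡-Reasoning

  deg-S-x : deg G S x ≡ a
  deg-S-x = sym (trans (deg-D x) (trans (cong (λ b → deg G S x + ⟦ b ⟧) (IsSimple.irrefl simple x)) (+-identityʳ _)))

  S-split : ∀ v → count S ≡ deg G S v + count (far v)
  S-split v = trans (count-split S (G v)) (cong (_+ count (far v)) (count-cong λ u → ∧-comm (S u) (G v u)))

  S-in-D : ∀ {u} → S u ≡ true → Dᵇ u ≡ true × u ≢ x
  S-in-D {u} Su = let Du , u∉x = ∧-true {Dᵇ u} Su
                  in Du , λ u≡x → false≢true (trans (sym (not-true u∉x)) (trans (cong ⟪ x ⟫ u≡x) (⟪⟫-self x)))

  far-spec : ∀ {v u} → far v u ≡ true → S u ≡ true × G v u ≡ false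
  far-spec {v} {u} eq = let Su , ¬Gvu = ∧-true {S u} eq in Su , not-true ¬Gvu

  K-exists : ∃[ K ] (K ⊆ far x × count K ≡ p ∸ a)
  K-exists = take (p ∸ a) (far x)
    (m≤n+o⇒m∸n≤o p a (subst (p ≤_) (trans (S-split x) (cong (_+ count (far x)) deg-S-x)) p≤∣S∣))

  K : VSet n
  K = proj₁ K-exists

  K-far : ∀ {u} → K u ≡ true → S u ≡ true × G x u ≡ false
  K-far {u} Ku = far-spec (proj₁ (proj₂ K-exists) u Ku)

  ∣K∣ : count K ≡ p ∸ a
  ∣K∣ = proj₂ (proj₂ K-exists)

  z : Fin n → Fin n
  z v = choose (far v) x

  -- A p-private neighbour of x has p − 1 neighbours in S, so some vertex of S is far from it.
  private-deg : ∀ {v} → PN v ≡ true → deg G S v + 1 ≡ p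
  private-deg {v} v∈PN =
    let _ , Gxv , deg≡p = PN-spec v∈PN
    in trans (cong (λ b → deg G S v + ⟦ b ⟧) (sym (trans (IsSimple.sym simple v x) Gxv))) (trans (sym (deg-D v)) deg≡p)

  z-far : ∀ {v} → PN v ≡ true → far v (z v) ≡ true
  z-far {v} v∈PN = choose-∈ (far v) x
    (+-cancelˡ-≤ (deg G S v) 1 (count (far v)) (subst₂ _≤_ (sym (private-deg v∈PN)) (S-split v) p≤∣S∣))

  -- The new edges, each listed once from its endpoint outside the old neighbourhoods.
  R : Adj n
  R i j = (K i ∧ ⟪ x ⟫ j) ∨ (PN i ∧ ⟪ z i ⟫ j)

  B : Adj n
  B = symmetrise R

  R-cases : ∀ {i j} → R i j ≡ true → (K i ≡ true × j ≡ x) ⊎ (PN i ≡ true × j ≡ z i)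
  R-cases {i} {j} Rij with ∨-true {K i ∧ ⟪ x ⟫ j} Rij
  ... | inj₁ e = let Ki , j≡x  = ∧-true {K i} e  in inj₁ (Ki , ⟪⟫-elim j≡x)
  ... | inj₂ e = let PNi , j≡z = ∧-true {PN i} e in inj₂ (PNi , ⟪⟫-elim j≡z)

  R-fresh : ∀ {i j} → R i j ≡ true → G i j ≡ false × i ≢ j
  R-fresh {i} {j} Rij with R-cases Rij
  ... | inj₁ (Ki , refl) = let Si , ¬Gxi = K-far Ki
                           in trans (IsSimple.sym simple i x) ¬Gxi , proj₂ (S-in-D Si)
  ... | inj₂ (PNi , refl) = let Sz , ¬Giz = far-spec (z-far PNi)
                            in ¬Giz , λ i≡z → false≢true (trans (sym (proj₁ (PN-spec PNi)))
                                                                (trans (cong Dᵇ i≡z) (proj₁ (S-in-D Sz))))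

  B-simple : IsSimple B
  B-simple = record { sym = λ i j → ∨-comm (R i j) (R j i) ; irrefl = irrefl }
    where
    irrefl : ∀ i → R i i ∨ R i i ≡ false
    irrefl i with R i i in Rii
    ... | true  = ⊥-elim (proj₂ (R-fresh Rii) refl)
    ... | false = refl

  B-new : ∀ i j → B i j ≡ true → G i j ≡ false
  B-new i j Bij with ∨-true {R i j} Bij
  ... | inj₁ Rij = proj₁ (R-fresh Rij)
  ... | inj₂ Rji = trans (IsSimple.sym simple i j) (proj₁ (R-fresh Rji))

  -- Row i of R has at most one entry from K and one from PN.
  B-size : edgeCount B ≤ (p ∸ a) + count PN
  B-size = begin
    edgeCount B                                ≤⟨ edgeCount-symmetrise R ⟩
    ∑[ i < n ] count (R i)                      ≤⟨ ∑-mono row ⟩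
    ∑[ i < n ] (⟦ K i ⟧ + ⟦ PN i ⟧)              ≡⟨ ∑-distrib-+ (⟦_⟧ ∘ K) (⟦_⟧ ∘ PN) ⟩
    count K + count PN                          ≡⟨ cong (_+ count PN) ∣K∣ ⟩
    (p ∸ a) + count PN                          ∎
    where
    open ≤-Reasoning
    row : ∀ i → count (R i) ≤ ⟦ K i ⟧ + ⟦ PN i ⟧
    row i = subst (count (R i) ≤_) (cong₂ _+_ (count-guarded-⟪⟫ (K i) x) (count-guarded-⟪⟫ (PN i) (z i)))
                  (count-∪-≤ (λ j → K i ∧ ⟪ x ⟫ j) (λ j → PN i ∧ ⟪ z i ⟫ j))

  R⇒B : ∀ {i j} → R i j ≡ true → B i j ≡ true
  R⇒B {i} {j} Rij = cong (_∨ R j i) Rij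

  R⇒Bᵀ : ∀ {i j} → R i j ≡ true → B j i ≡ true
  R⇒Bᵀ {i} {j} Rij = trans (cong (R j i ∨_) Rij) (∨-zeroʳ (R j i))

  R-K : ∀ {u} → K u ≡ true → R u x ≡ true
  R-K {u} Ku = cong₂ (λ k e → (k ∧ e) ∨ (PN u ∧ ⟪ z u ⟫ x)) Ku (⟪⟫-self x)

  R-z : ∀ {v} → PN v ≡ true → R v (z v) ≡ true
  R-z {v} PNv = trans (cong₂ (λ q e → (K v ∧ ⟪ x ⟫ (z v)) ∨ (q ∧ e)) PNv (⟪⟫-self (z v))) (∨-zeroʳ _)

  -- x keeps its a neighbours in D − x and gains the p ∸ a vertices of K.
  x-dominated : p ≤ deg (G ⊕ B) S x
  x-dominated = begin
    p                      ≤⟨ m≤n+m∸n p a ⟩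
    a + (p ∸ a)            ≡⟨ cong₂ _+_ (sym deg-S-x) (sym ∣K∣) ⟩
    deg G S x + count K    ≤⟨ count-disjoint (nbrs-⊕ G B S x) K-new disjoint ⟩
    deg (G ⊕ B) S x        ∎
    where
    open ≤-Reasoning
    K-new : K ⊆ nbrs (G ⊕ B) S x
    K-new u Ku = new-nbr G B {A = S} (R⇒Bᵀ (R-K Ku)) (proj₁ (K-far Ku))
    disjoint : Disjoint (nbrs G S x) K
    disjoint u Gxu∧Su with K u in Ku
    ... | true  = ⊥-elim (false≢true (trans (sym (proj₂ (K-far Ku))) (proj₁ (∧-true {G x u} Gxu∧Su))))
    ... | false = refl

  -- A private neighbour v keeps p − 1 neighbours in D − x and gains z v.
  private-dominated : ∀ {v} → PN v ≡ true → p ≤ deg (G ⊕ B) S v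
  private-dominated {v} PNv = begin
    p                          ≡⟨ sym (private-deg PNv) ⟩
    deg G S v + 1              ≡⟨ cong (deg G S v +_) (sym (count-⟪⟫ (z v))) ⟩
    deg G S v + count ⟪ z v ⟫  ≤⟨ count-disjoint (nbrs-⊕ G B S v) z-new disjoint ⟩
    deg (G ⊕ B) S v            ∎
    where
    open ≤-Reasoning
    z-new : ⟪ z v ⟫ ⊆ nbrs (G ⊕ B) S v
    z-new u u≡z = subst (λ w → nbrs (G ⊕ B) S v w ≡ true) (sym (⟪⟫-elim u≡z))
                        (new-nbr G B {A = S} (R⇒B (R-z PNv)) (proj₁ (far-spec (z-far PNv))))
    disjoint : Disjoint (nbrs G S v) ⟪ z v ⟫
    disjoint u Gvu∧Su with ⟪ z v ⟫ u in u≡z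
    ... | true  = ⊥-elim (false≢true (trans (sym (proj₂ (far-spec (z-far PNv))))
                                            (trans (cong (G v) (sym (⟪⟫-elim u≡z))) (proj₁ (∧-true {G v u} Gvu∧Su)))))
    ... | false = refl

  D-dominates : ∀ {v} → Dᵇ v ≡ false → p ≤ deg G Dᵇ v
  D-dominates {v} = dominating⇒ (proj₁ γ-set) v

  -- Any other vertex outside D already has p neighbours in D − x: if it is adjacent to x it
  -- is not p-private, so it has more than p neighbours in D.
  others-dominated : ∀ {v} → Dᵇ v ≡ false → PN v ≡ false → p ≤ deg G S v
  others-dominated {v} ¬Dv ¬PNv with G v x in Gvx
  ... | false = subst (p ≤_) (trans (deg-D v) (trans (cong (λ b → deg G S v + ⟦ b ⟧) Gvx) (+-identityʳ _)))
                      (D-dominates ¬Dv)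
  ... | true  = ≤-pred (subst (suc p ≤_) (trans (deg-D v) (trans (cong (λ b → deg G S v + ⟦ b ⟧) Gvx) (+-comm _ 1)))
                               (≤∧≢⇒< (D-dominates ¬Dv) (≢-sym deg≢p)))
    where
    deg≢p : deg G Dᵇ v ≢ p
    deg≢p = does-false (deg G Dᵇ v ≟ p)
      (trans (sym (cong₂ (λ d g → not d ∧ (g ∧ ⌊ deg G Dᵇ v ≟ p ⌋)) ¬Dv (trans (IsSimple.sym simple x v) Gvx))) ¬PNv)

  S-dominating : Dominating (G ⊕ B) p S
  S-dominating v ¬Sv with v Fin.≟ x
  ... | yes refl = x-dominated
  ... | no  v≢x with true-or-false (PN v)
  ...   | inj₁ PNv  = private-dominated PNv
  ...   | inj₂ ¬PNv = ≤-trans (others-dominated ¬Dv ¬PNv) (count-mono (nbrs-⊕ G B S v))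
    where
    ¬Dv : Dᵇ v ≡ false
    ¬Dv = trans (sym (∧-identityʳ (Dᵇ v))) (trans (cong (λ b → Dᵇ v ∧ not b) (sym (⟪⟫-other v≢x))) ¬Sv)

  -- Hence γ_p(G ⊕ B) ≤ |D − x| < |D| = γ_p(G).
  reinforcing : Reinforcing G p B
  reinforcing = B-simple , B-new , ∣ D ∣ , ∣ S* ∣ , (D , γ-set , refl) , (S* , S*-γ-set , refl) , ∣S*∣<∣D∣
    where
    smaller : ∃[ S* ] (IsGammaSet (G ⊕ B) p S* × ∣ S* ∣ ≤ ∣ tabulate S ∣)
    smaller = γ-set-below (G ⊕ B) p (tabulate S) (⇒dominating S-dominating)
    S* : Subset n
    S* = proj₁ smaller
    S*-γ-set : IsGammaSet (G ⊕ B) p S*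
    S*-γ-set = proj₁ (proj₂ smaller)
    ∣S*∣<∣D∣ : ∣ S* ∣ < ∣ D ∣
    ∣S*∣<∣D∣ = subst (suc ∣ S* ∣ ≤_) (trans (+-comm 1 (count S)) (sym ∣D∣≡∣S∣+1))
                     (s≤s (≤-trans (proj₂ (proj₂ smaller))
                                   (≤-reflexive (trans (∣∣≡count (tabulate S)) (count-cong (lookup∘tabulate S))))))

private-reinforcement : ∀ {n} {G : Adj n} → IsSimple G → ∀ {p} {D : Subset n} → IsGammaSet G p D → p < ∣ D ∣ →
  ∀ {x} → x ∈ D → ∃[ B ] (Reinforcing G p B × edgeCount B ≤ (p ∸ deg G (lookup D) x) + count (privateNbr G p (lookup D) x))
private-reinforcement simple γ-set p<∣D∣ x∈D = B , reinforcing , B-size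
  where open PrivateReinforcement simple γ-set p<∣D∣ (∈⇒true x∈D)

reinforcement-number-facts : ∀ {n} {G : Adj n} {p} {D : Subset n} → IsReinforcementNumber G p (suc p) → IsGammaSet G p D →
  p < ∣ D ∣ × (∀ B → Reinforcing G p B → suc p ≤ edgeCount B)
reinforcement-number-facts (inj₁ (_ , ())) _
reinforcement-number-facts {p = p} (inj₂ ((g , (D₀ , γ-set₀ , ∣D₀∣≡g) , p<g) , _ , minimal)) γ-set =
  ≤-trans (subst (p <_) (sym ∣D₀∣≡g) p<g) (proj₂ γ-set₀ _ (proj₁ γ-set)) , minimal

private-count : ∀ {n} {G : Adj n} → IsSimple G → ∀ {p} {D : Subset n} → IsGammaSet G p D → p < ∣ D ∣ →
  (∀ B → Reinforcing G p B → suc p ≤ edgeCount B) →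
  ∀ {x} → x ∈ D → suc p ≤ (p ∸ deg G (lookup D) x) + count (privateNbr G p (lookup D) x)
private-count simple γ-set p<∣D∣ minimal x∈D =
  let B , reinforcing , size = private-reinforcement simple γ-set p<∣D∣ x∈D in ≤-trans (minimal B reinforcing) size

-- Part (i): p + 1 ≤ (p ∸ a) + |PN_p(x, D)| ≤ p + |PN_p(x, D)|, so x has a p-private neighbour.
has-private-neighbour : ∀ {n} {G : Adj n} → IsSimple G → ∀ {p} {D : Subset n} → IsGammaSet G p D → p < ∣ D ∣ →
  (∀ B → Reinforcing G p B → suc p ≤ edgeCount B) → ∀ {x} → x ∈ D → ∃[ y ] IsPrivateNbr G p x D y
has-private-neighbour {G = G} simple {p} {D} γ-set p<∣D∣ minimal {x} x∈D =
  let y , PNy = count-witness PN (+-cancelˡ-≤ p 1 (count PN) p+1≤p+∣PN∣)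
      ¬Dy , Gxy , deg≡p = privateNbr-spec {G = G} {p} {lookup D} {x} PNy
  in y , false⇒∉ ¬Dy , Gxy , trans (∣N∩∣≡deg G D y) deg≡p
  where
  PN : VSet _
  PN = privateNbr G p (lookup D) x
  p+1≤p+∣PN∣ : p + 1 ≤ p + count PN
  p+1≤p+∣PN∣ = ≤-trans (≤-reflexive (+-comm p 1))
                 (≤-trans (private-count simple γ-set p<∣D∣ minimal x∈D) (+-monoˡ-≤ (count PN) (m∸n≤m p (deg G (lookup D) x))))

shortest-repetition : ∀ {n} (f : ℕ → Fin n) → ∀ d i → 0 < d → f i ≡ f (i + d) →
  ∃[ i′ ] ∃[ d′ ] (0 < d′ × f i′ ≡ f (i′ + d′) × Injective _≡_ _≡_ (λ (s : Fin d′) → f (i′ + toℕ s)))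
shortest-repetition {n} f = <-rec _ shrink
  where
  Shrinkable : ℕ → Set
  Shrinkable d = ∀ i → 0 < d → f i ≡ f (i + d) →
    ∃[ i′ ] ∃[ d′ ] (0 < d′ × f i′ ≡ f (i′ + d′) × Injective _≡_ _≡_ (λ (s : Fin d′) → f (i′ + toℕ s)))
  shrink : ∀ d → (∀ {d′} → d′ < d → Shrinkable d′) → Shrinkable d
  shrink d smaller i 0<d rep
    with Fin.any? (λ s → Fin.any? (λ t → (toℕ s <? toℕ t) ×-dec (f (i + toℕ s) Fin.≟ f (i + toℕ t))))
  ... | yes (s , t , s<t , inner) =
    smaller (≤-<-trans (m∸n≤m (toℕ t) (toℕ s)) (Fin.toℕ<n t)) (i + toℕ s) (m<n⇒0<n∸m s<t)
            (trans inner (cong f (sym (trans (+-assoc i (toℕ s) _) (cong (i +_) (m+[n∸m]≡n (<⇒≤ s<t)))))))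
  ... | no none = i , d , 0<d , rep , injective
    where
    injective : Injective _≡_ _≡_ (λ (s : Fin d) → f (i + toℕ s))
    injective {s} {t} eq with Fin.<-cmp s t
    ... | tri< s<t _ _ = ⊥-elim (none (s , t , s<t , eq))
    ... | tri≈ _ s≡t _ = s≡t
    ... | tri> _ _ t<s = ⊥-elim (none (t , s , t<s , sym eq))

-- If every vertex of a set W containing w₀ has at least two neighbours in W, then G has a
-- cycle: walk inside W without ever stepping straight back; the walk must revisit a vertex,
-- and its shortest closed stretch is a cycle.
module BranchingSetHasCycle {n} {G : Adj n} (simple : IsSimple G) (W : VSet n) (w₀ : Fin n)
  (w₀∈W : W w₀ ≡ true) (branching : ∀ v → W v ≡ true → 2 ≤ deg G W v) where

  onward : Fin n → Fin n → Fin n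
  onward u v = choose (nbrs G W v ─ ⟪ u ⟫) v

  onward-spec : ∀ u v → W v ≡ true → nbrs G W v (onward u v) ≡ true × onward u v ≢ u
  onward-spec u v v∈W =
    let spec = choose-∈ (nbrs G W v ─ ⟪ u ⟫) v (+-cancelʳ-≤ 1 1 _ two≤)
        nbr , ¬u = ∧-true {nbrs G W v (onward u v)} spec
    in nbr , λ eq → false≢true (trans (sym (not-true ¬u)) (trans (cong ⟪ u ⟫ eq) (⟪⟫-self u)))
    where
    two≤ : 2 ≤ count (nbrs G W v ─ ⟪ u ⟫) + 1
    two≤ = ≤-trans (branching v v∈W) (≤-trans (≤-reflexive (count-remove (nbrs G W v) u))
                                               (+-monoʳ-≤ _ (⟦⟧≤1 (nbrs G W v u))))

  walk : ℕ → Fin n × Fin n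
  walk zero    = w₀ , onward w₀ w₀
  walk (suc k) = proj₂ (walk k) , onward (proj₁ (walk k)) (proj₂ (walk k))

  f : ℕ → Fin n
  f k = proj₁ (walk k)

  previous : ℕ → Fin n
  previous zero    = w₀
  previous (suc k) = f k

  f-step : ∀ k → f (suc k) ≡ onward (previous k) (f k)
  f-step zero    = refl
  f-step (suc k) = refl

  walk-step : ∀ k → W (f k) ≡ true → nbrs G W (f k) (f (suc k)) ≡ true
  walk-step k fk∈W = subst (λ w → nbrs G W (f k) w ≡ true) (sym (f-step k)) (proj₁ (onward-spec (previous k) (f k) fk∈W))

  f-in-W : ∀ k → W (f k) ≡ true
  f-in-W zero    = w₀∈W
  f-in-W (suc k) = proj₂ (∧-true {G (f k) (f (suc k))} (walk-step k (f-in-W k)))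

  edge : ∀ k → G (f k) (f (suc k)) ≡ true
  edge k = proj₁ (∧-true {G (f k) (f (suc k))} (walk-step k (f-in-W k)))

  no-backtrack : ∀ k → f (suc (suc k)) ≢ f k
  no-backtrack k = proj₂ (onward-spec (f k) (f (suc k)) (f-in-W (suc k)))

  -- A repetition-free closed stretch of the walk is a cycle: it has length at least 3, since
  -- G is loopless and the walk does not backtrack.
  closed-stretch : ∀ i d → 0 < d → f i ≡ f (i + d) → Injective _≡_ _≡_ (λ (s : Fin d) → f (i + toℕ s)) → HasCycle G
  closed-stretch i 1 _ rep _ =
    ⊥-elim (false≢true (trans (sym (IsSimple.irrefl simple (f i))) (trans (cong (G (f i)) (trans rep (cong f (+-comm i 1)))) (edge i))))
  closed-stretch i 2 _ rep _ = ⊥-elim (no-backtrack i (sym (trans rep (cong f (+-comm i 2)))))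
  closed-stretch i (suc (suc (suc k))) _ rep injective = k , c , injective , edges , closing
    where
    c : Fin (3 + k) → Fin n
    c s = f (i + toℕ s)
    edges : ∀ (s : Fin (2 + k)) → G (c (inject₁ s)) (c (suc s)) ≡ true
    edges s = subst₂ (λ a b → G (f a) (f b) ≡ true)
                     (cong (i +_) (sym (Fin.toℕ-inject₁ s))) (sym (+-suc i (toℕ s))) (edge (i + toℕ s))
    closing : G (c (fromℕ (2 + k))) (c zero) ≡ true
    closing = subst₂ (λ a b → G (f a) b ≡ true)
                     (cong (i +_) (sym (Fin.toℕ-fromℕ (2 + k))))
                     (trans (cong f (sym (+-suc i (2 + k)))) (trans (sym rep) (cong f (sym (+-identityʳ i)))))
                     (edge (i + (2 + k)))

  cycle : HasCycle G
  cycle =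
    let s , t , s<t , rep = Fin.pigeonhole (n<1+n n) (λ t → f (toℕ t))
        i , d , 0<d , rep′ , injective = shortest-repetition f (toℕ t ∸ toℕ s) (toℕ s) (m<n⇒0<n∸m s<t)
                                           (trans rep (cong f (sym (m+[n∸m]≡n (<⇒≤ s<t)))))
    in closed-stretch i d 0<d rep′ injective

leaf-exists : ∀ {n} {G : Adj n} → IsSimple G → (HasCycle G → ⊥) → ∀ (W : VSet n) → 0 < count W →
  ∃[ ℓ ] (W ℓ ≡ true × deg G W ℓ ≤ 1)
leaf-exists {G = G} simple acyclic W nonempty
  with Fin.any? (λ ℓ → (W ℓ Bool.≟ true) ×-dec (deg G W ℓ ≤? 1))
... | yes leaf = leaf
... | no  none =
  let w₀ , w₀∈W = count-witness W nonempty
  in ⊥-elim (acyclic (BranchingSetHasCycle.cycle simple W w₀ w₀∈W λ v v∈W → ≰⇒> (λ deg≤1 → none (v , v∈W , deg≤1))))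

pairs-remove : ∀ {n} {G : Adj n} → IsSimple G → ∀ W ℓ → W ℓ ≡ true →
  pairs G W W ≡ pairs G (W ─ ⟪ ℓ ⟫) (W ─ ⟪ ℓ ⟫) + 2 * deg G (W ─ ⟪ ℓ ⟫) ℓ
pairs-remove {G = G} simple W ℓ ℓ∈W = begin
  pairs G W W                                          ≡⟨ pairs-cong G W-split W-split ⟩
  pairs G (W′ ∪ L) (W′ ∪ L)                             ≡⟨ pairs-∪ˡ G (W′ ∪ L) disjoint ⟩
  pairs G W′ (W′ ∪ L) + pairs G L (W′ ∪ L)              ≡⟨ cong₂ _+_ (pairs-∪ʳ simple W′ disjoint) (pairs-∪ʳ simple L disjoint) ⟩
  (pairs G W′ W′ + pairs G W′ L) + (pairs G L W′ + pairs G L L)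
    ≡⟨ cong₂ (λ d₁ d₂ → (pairs G W′ W′ + d₁) + (d₂ + pairs G L L)) (pairs-⟪⟫ʳ simple W′ ℓ)
             (trans (pairs-sym simple L W′) (pairs-⟪⟫ʳ simple W′ ℓ)) ⟩
  (pairs G W′ W′ + d) + (d + pairs G L L)               ≡⟨ cong (λ e → (pairs G W′ W′ + d) + (d + e)) no-loop ⟩
  (pairs G W′ W′ + d) + (d + 0)                         ≡⟨ arithmetic (pairs G W′ W′) d ⟩
  pairs G W′ W′ + 2 * d                                 ∎
  where
  open ≡-Reasoning
  W′ L : VSet _
  W′ = W ─ ⟪ ℓ ⟫
  L  = ⟪ ℓ ⟫
  d : ℕ
  d = deg G W′ ℓ
  W-split : ∀ u → W u ≡ (W′ ∪ L) u
  W-split u with L u in u≡ℓ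
  ... | true  = trans (subst (λ w → W w ≡ true) (sym (⟪⟫-elim u≡ℓ)) ℓ∈W) (sym (∨-zeroʳ (W u ∧ false)))
  ... | false = sym (trans (∨-identityʳ (W u ∧ true)) (∧-identityʳ (W u)))
  disjoint : Disjoint W′ L
  disjoint u W′u = not-true (proj₂ (∧-true {W u} W′u))
  no-loop : pairs G L L ≡ 0
  no-loop = trans (pairs-⟪⟫ʳ simple L ℓ) (trans (count-point (G ℓ) ℓ) (cong ⟦_⟧ (IsSimple.irrefl simple ℓ)))
  arithmetic : ∀ P d → (P + d) + (d + 0) ≡ P + 2 * d
  arithmetic = solve-∀

remove-leaf : ∀ {n} {G : Adj n} → IsSimple G → (HasCycle G → ⊥) → ∀ {m} (W : VSet n) → count W ≡ suc m →
  ∃[ ℓ ] (count (W ─ ⟪ ℓ ⟫) ≡ m × deg G (W ─ ⟪ ℓ ⟫) ℓ ≤ 1 × pairs G W W ≡ pairs G (W ─ ⟪ ℓ ⟫) (W ─ ⟪ ℓ ⟫) + 2 * deg G (W ─ ⟪ ℓ ⟫) ℓ)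
remove-leaf {G = G} simple acyclic W ∣W∣ =
  let ℓ , ℓ∈W , leaf = leaf-exists simple acyclic W (subst (0 <_) (sym ∣W∣) (s≤s z≤n))
      ∣W−ℓ∣ = suc-injective (trans (sym (+-comm (count (W ─ ⟪ ℓ ⟫)) 1))
                                  (trans (cong (λ b → count (W ─ ⟪ ℓ ⟫) + ⟦ b ⟧) (sym ℓ∈W))
                                         (trans (sym (count-remove W ℓ)) ∣W∣)))
  in ℓ , ∣W−ℓ∣ , ≤-trans (deg-mono G ℓ (λ u e → proj₁ (∧-true {W u} e))) leaf , pairs-remove simple W ℓ ℓ∈W

forest-bound : ∀ {n} {G : Adj n} → IsSimple G → (HasCycle G → ⊥) → ∀ m (W : VSet n) → count W ≡ suc m →
  pairs G W W + 2 ≤ 2 * count W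
forest-bound {G = G} simple acyclic m W ∣W∣ with remove-leaf simple acyclic W ∣W∣
... | ℓ , ∣W′∣ , d≤1 , removal = bound m ∣W′∣
  where
  W′ : VSet _
  W′ = W ─ ⟪ ℓ ⟫
  d : ℕ
  d = deg G W′ ℓ
  bound : ∀ m′ → count W′ ≡ m′ → pairs G W W + 2 ≤ 2 * count W
  bound zero ∣W′∣≡0 = ≤-reflexive (begin
    pairs G W W + 2              ≡⟨ cong (_+ 2) removal ⟩
    pairs G W′ W′ + 2 * d + 2    ≡⟨ cong₂ (λ P e → P + 2 * e + 2) (pairs-empty G W′ W′ ∣W′∣≡0)
                                          (n≤0⇒n≡0 (≤-trans (deg≤count G W′ ℓ) (≤-reflexive ∣W′∣≡0))) ⟩
    2                            ≡⟨ cong (2 *_) (sym (trans ∣W∣ (cong suc (trans (sym ∣W′∣) ∣W′∣≡0)))) ⟩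
    2 * count W                  ∎)
    where open ≡-Reasoning
  bound (suc m′) ∣W′∣≡1+m′ = begin
    pairs G W W + 2              ≡⟨ cong (_+ 2) removal ⟩
    pairs G W′ W′ + 2 * d + 2    ≤⟨ +-monoˡ-≤ 2 (+-monoʳ-≤ (pairs G W′ W′) (*-monoʳ-≤ 2 d≤1)) ⟩
    pairs G W′ W′ + 2 + 2        ≤⟨ +-monoˡ-≤ 2 (forest-bound simple acyclic m′ W′ ∣W′∣≡1+m′) ⟩
    2 * count W′ + 2             ≡⟨ trans (cong (λ k → 2 * k + 2) ∣W′∣≡1+m′) (arithmetic m′) ⟩
    2 * suc (suc m′)             ≡⟨ cong (2 *_) (sym (trans ∣W∣ (cong suc (trans (sym ∣W′∣) ∣W′∣≡1+m′)))) ⟩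
    2 * count W                  ∎
    where
    open ≤-Reasoning
    arithmetic : ∀ k → 2 * suc k + 2 ≡ 2 * suc (suc k)
    arithmetic = solve-∀

-- Uniqueness of the γ_p-set in a tree with r_p = p + 1.  Let D′ be a second γ_p-set,
-- X = D − D′, Y = D′ − D, and Q the vertices outside D ∪ D′ that are p-private neighbours
-- (w.r.t. D) of some vertex of X.  Every x ∈ X has two neighbours in Y ∪ Q and every q ∈ Q
-- has a neighbour in Y, so the forest induced on W = X ∪ Y ∪ Q has at least 2|X| + |Q| edges,
-- hence |W| > 2|X| + |Q|, that is |Y| > |X|.  Since |D′| ≤ |D| forces |Y| ≤ |X|, W is empty.
module Uniqueness {n} {G : Adj n} (simple : IsSimple G) (acyclic : HasCycle G → ⊥) {p} (2≤p : 2 ≤ p)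
  {D D′ : Subset n} (γ-set : IsGammaSet G p D) (γ-set′ : IsGammaSet G p D′) (p<∣D∣ : p < ∣ D ∣)
  (minimal : ∀ B → Reinforcing G p B → suc p ≤ edgeCount B) where

  Dᵇ Eᵇ X Y Q Z W : VSet n
  Dᵇ = lookup D
  Eᵇ = lookup D′
  X = Dᵇ ─ Eᵇ
  Y = Eᵇ ─ Dᵇ
  Q v = not (Dᵇ v) ∧ (not (Eᵇ v) ∧ (⌊ deg G Dᵇ v ≟ p ⌋ ∧ ⌊ 1 ≤? deg G X v ⌋))
  Z = Y ∪ Q
  W = X ∪ Z

  Q-intro : ∀ {u} → Dᵇ u ≡ false → Eᵇ u ≡ false → deg G Dᵇ u ≡ p → 1 ≤ deg G X u → Q u ≡ true
  Q-intro {u} ¬Du ¬Eu deg≡p has-X =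
    trans (cong₂ (λ d e → not d ∧ (not e ∧ (⌊ deg G Dᵇ u ≟ p ⌋ ∧ ⌊ 1 ≤? deg G X u ⌋))) ¬Du ¬Eu)
          (cong₂ _∧_ (true-does (deg G Dᵇ u ≟ p) deg≡p) (true-does (1 ≤? deg G X u) has-X))

  Q-elim : ∀ {u} → Q u ≡ true → Dᵇ u ≡ false × Eᵇ u ≡ false × deg G Dᵇ u ≡ p × 1 ≤ deg G X u
  Q-elim {u} Qu =
    let ¬Du , rest = ∧-true {not (Dᵇ u)} Qu ; ¬Eu , conds = ∧-true {not (Eᵇ u)} rest
        deg≡p , has-X = ∧-true {⌊ deg G Dᵇ u ≟ p ⌋} conds
    in not-true ¬Du , not-true ¬Eu , does-true (deg G Dᵇ u ≟ p) deg≡p , does-true (1 ≤? deg G X u) has-X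

  X∩Z=∅ : Disjoint X Z
  X∩Z=∅ u Xu with Dᵇ u | Eᵇ u | Xu
  ... | true | false | _ = refl

  Y∩Q=∅ : Disjoint Y Q
  Y∩Q=∅ u Yu with Dᵇ u | Eᵇ u | Yu
  ... | false | true | _ = refl

  deg-D′ : ∀ v → deg G Eᵇ v ≡ deg G (Dᵇ & Eᵇ) v + deg G Y v
  deg-D′ v = trans (deg-split G Eᵇ Dᵇ v) (cong (_+ deg G Y v) (count-cong λ u → cong (G v u ∧_) (∧-comm (Eᵇ u) (Dᵇ u))))

  D′-dominates : ∀ {v} → Eᵇ v ≡ false → p ≤ deg G (Dᵇ & Eᵇ) v + deg G Y v
  D′-dominates {v} ¬Ev = subst (p ≤_) (deg-D′ v) (dominating⇒ (proj₁ γ-set′) v ¬Ev)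

  -- Every vertex of X has at least two neighbours in Y ∪ Q: D′ supplies p ∸ a of them in Y,
  -- and the p-private neighbours of x lie in Y ∪ Q.
  X-branching : ∀ v → X v ≡ true → 2 ≤ deg G Z v
  X-branching v Xv = two≤ (≤-trans (s≤s 2≤p) (≤-trans p+1≤ (+-mono-≤ Y≤Z ≤-refl)))
    where
    Dv : Dᵇ v ≡ true
    Dv = proj₁ (∧-true {Dᵇ v} Xv)
    ¬Ev : Eᵇ v ≡ false
    ¬Ev = not-true (proj₂ (∧-true {Dᵇ v} Xv))
    two≤ : ∀ {k} → 3 ≤ k + k → 2 ≤ k
    two≤ {suc (suc k)} _ = s≤s (s≤s z≤n)
    two≤ {suc zero} (s≤s (s≤s ()))
    Y≤Z : deg G Y v ≤ deg G Z v
    Y≤Z = deg-mono G v λ u Yu → cong (_∨ Q u) Yu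
    p∸a≤Y : p ∸ deg G Dᵇ v ≤ deg G Y v
    p∸a≤Y = m≤n+o⇒m∸n≤o p _ (≤-trans (D′-dominates ¬Ev)
              (+-monoˡ-≤ (deg G Y v) (deg-mono G v λ u DEu → proj₁ (∧-true {Dᵇ u} DEu))))
    PN⊆Z : privateNbr G p Dᵇ v ⊆ nbrs G Z v
    PN⊆Z u PNu with privateNbr-spec {G = G} {p} {Dᵇ} {v} PNu
    ... | ¬Du , Gvu , deg≡p = cong₂ _∧_ Gvu (in-Z (Eᵇ u) refl)
      where
      has-X : 1 ≤ deg G X u
      has-X = count-∋ (nbrs G X u) (cong₂ _∧_ (trans (IsSimple.sym simple u v) Gvu) Xv)
      in-Z : ∀ e → Eᵇ u ≡ e → Z u ≡ true
      in-Z true  Eu = cong₂ (λ d e → (e ∧ not d) ∨ Q u) ¬Du Eu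
      in-Z false Eu = trans (cong (Y u ∨_) (Q-intro ¬Du Eu deg≡p has-X)) (∨-zeroʳ (Y u))
    p+1≤ : suc p ≤ deg G Y v + deg G Z v
    p+1≤ = ≤-trans (private-count simple γ-set p<∣D∣ minimal (true⇒∈ Dv)) (+-mono-≤ p∸a≤Y (count-mono PN⊆Z))

  -- A vertex of Q has exactly p neighbours in D, one of them in X, and at least p in D′; the
  -- common part of D and D′ contributes equally, so Y contributes at least as much as X.
  Q-has-Y : ∀ q → Q q ≡ true → 1 ≤ deg G Y q
  Q-has-Y q Qq =
    let _ , ¬Eq , deg≡p , has-X = Q-elim Qq
    in ≤-trans has-X (+-cancelˡ-≤ (deg G (Dᵇ & Eᵇ) q) (deg G X q) (deg G Y q)
                        (subst (_≤ deg G (Dᵇ & Eᵇ) q + deg G Y q) (trans (sym deg≡p) (deg-split G Dᵇ Eᵇ q))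
                               (D′-dominates ¬Eq)))

  -- |D′| ≤ |D|, and D and D′ share the common part.
  ∣Y∣≤∣X∣ : count Y ≤ count X
  ∣Y∣≤∣X∣ = +-cancelˡ-≤ (count (Dᵇ & Eᵇ)) _ _ (subst₂ _≤_ ∣D′∣ ∣D∣ (proj₂ γ-set′ D (proj₁ γ-set)))
    where
    ∣D∣ : ∣ D ∣ ≡ count (Dᵇ & Eᵇ) + count X
    ∣D∣ = trans (∣∣≡count D) (count-split Dᵇ Eᵇ)
    ∣D′∣ : ∣ D′ ∣ ≡ count (Dᵇ & Eᵇ) + count Y
    ∣D′∣ = trans (∣∣≡count D′) (trans (count-split Eᵇ Dᵇ) (cong (_+ count Y) (count-cong λ u → ∧-comm (Eᵇ u) (Dᵇ u))))

  Y-exceeds-X : ∀ m → count W ≡ suc m → count X < count Y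
  Y-exceeds-X m ∣W∣ = halve (count X) (count Y) (count Q) (begin
    2 * (2 * count X) + 2 * (1 * count Q) + 2
      ≤⟨ +-monoˡ-≤ 2 (+-mono-≤ (*-monoʳ-≤ 2 (pairs-lower G X Z 2 X-branching))
                               (*-monoʳ-≤ 2 (pairs-lower G Q Y 1 Q-has-Y))) ⟩
    2 * pairs G X Z + 2 * pairs G Q Y + 2
      ≤⟨ +-monoˡ-≤ 2 (pairs-three simple X∩Z=∅ Y∩Q=∅) ⟩
    pairs G W W + 2
      ≤⟨ forest-bound simple acyclic m W ∣W∣ ⟩
    2 * count W
      ≡⟨ cong (2 *_) (trans (count-∪ X∩Z=∅) (cong (count X +_) (count-∪ Y∩Q=∅))) ⟩
    2 * (count X + (count Y + count Q))
      ∎)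
    where
    open ≤-Reasoning
    halve : ∀ x y q → 2 * (2 * x) + 2 * (1 * q) + 2 ≤ 2 * (x + (y + q)) → suc x ≤ y
    halve x y q h = +-cancelʳ-≤ (x + q) (suc x) y
      (subst (suc x + (x + q) ≤_) (swap x y q) (*-cancelˡ-≤ 2 (subst (_≤ 2 * (x + (y + q))) (double x q) h)))
      where
      double : ∀ x q → 2 * (2 * x) + 2 * (1 * q) + 2 ≡ 2 * (suc x + (x + q))
      double = solve-∀
      swap : ∀ x y q → x + (y + q) ≡ y + (x + q)
      swap = solve-∀

  W-empty : count W ≡ 0 → D′ ≡ D
  W-empty ∣W∣≡0 = trans (sym (tabulate∘lookup D′)) (trans (tabulate-cong same) (tabulate∘lookup D))
    where
    outside-W : ∀ u → W u ≡ false
    outside-W = count-zero W ∣W∣≡0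
    same : ∀ u → Eᵇ u ≡ Dᵇ u
    same u with Dᵇ u | Eᵇ u | outside-W u
    ... | true  | true  | _ = refl
    ... | false | false | _ = refl

  D′≡D : D′ ≡ D
  D′≡D with count W in ∣W∣
  ... | zero  = W-empty ∣W∣
  ... | suc m = ⊥-elim (<⇒≱ (Y-exceeds-X m ∣W∣) ∣Y∣≤∣X∣)

theorem3p2 : ∀ {n : ℕ} (p : ℕ) (T : Adj n) (D : Subset n)
    → 2 ≤ p → IsTree T → IsReinforcementNumber T p (ℕ.suc p)
    → IsGammaSet T p D
    → (∀ (x : Fin n) → x ∈ D → ∃[ y ] IsPrivateNbr T p x D y)
    × (∀ (D′ : Subset n) → IsGammaSet T p D′ → D′ ≡ D)
theorem3p2 p T D 2≤p (simple , _ , acyclic) r≡p+1 γ-set =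
  (λ x x∈D → has-private-neighbour simple γ-set p<∣D∣ minimal x∈D) ,
  (λ D′ γ-set′ → Uniqueness.D′≡D simple acyclic 2≤p γ-set γ-set′ p<∣D∣ minimal)
  where
  p<∣D∣ : p < ∣ D ∣
  p<∣D∣ = proj₁ (reinforcement-number-facts r≡p+1 γ-set)
  minimal : ∀ B → Reinforcing T p B → ℕ.suc p ≤ edgeCount B
  minimal = proj₂ (reinforcement-number-facts r≡p+1 γ-set)
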